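{- Let $\mathcal C=\bigcup_{n\ge1}\mathcal A_n(\{0121,0112\})$. For $x\in\mathcal C$ let $x^+$ be the subsequence of positive entries of $x$. Every $x\in\mathcal C$ falls into exactly one of the following three classes: label $(0)$: $x=0^i$ for some $i\ge1$; label $(01)$: $x^+=12\cdots m$ for some $m\ge1$; label $(011)$: $x^+=12\cdots(m-1)m^s$ for some $m\ge1$ and $s\ge2$. Moreover, for $x\in\mathcal C$ of length $n$, call a child of $x$ any sequence $xt\in\mathcal A_{n+1}(\{0121,0112\})$ obtained by appending a letter $t$. Then: every $x$ with label $(0)$ has exactly two children, with labels $(0)$ and $(01)$; every $x$ with label $(01)$ has exactly three children, with labels $(01)$, $(011)$, $(01)$; every $x$ with label $(011)$ has exactly two children, both with label $(011)$. (The root is the sequence $0$, with label $(0)$.)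
   Context: An ascent in an integer sequence $s_1\cdots s_m$ is an index $j$ with $s_j<s_{j+1}$; $\mathrm{asc}(s)$ is the number of ascents. An ascent sequence is a sequence $x_1\cdots x_n$ of nonnegative integers with $x_1=0$ and $x_i\le 1+\mathrm{asc}(x_1\cdots x_{i-1})$ for $i\ge2$. For a sequence $w$, $\mathrm{red}(w)$ replaces the $i$-th smallest distinct letter of $w$ by $i-1$. A pattern (e.g. $0121$, meaning the sequence $(0,1,2,1)$) is a sequence equal to its reduction. A sequence $x$ contains pattern $p=p_1\cdots p_k$ if there are indices $i_1<\cdots<i_k$ with $\mathrm{red}(x_{i_1}\cdots x_{i_k})=p$; otherwise it avoids $p$. For a set of patterns $P$, $\mathcal A_n(P)$ is the set of ascent sequences of length $n$ avoiding every pattern in $P$. -}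

module Defs where

open import Data.Nat using (ℕ; zero; suc; _∸_; _≤_; _<_; _<ᵇ_; _≟_; _<?_)
open import Data.Bool using (if_then_else_)
open import Data.List using (List; []; _∷_; _++_; [_]; map; filter; replicate; length; upTo)
open import Data.List.Relation.Unary.Any using (any?)
open import Data.List.Relation.Binary.Sublist.Propositional using (_⊆_)
open import Data.Product using (Σ; _×_; ∃; ∃-syntax)
open import Data.Sum using (_⊎_)
open import Data.Unit using (⊤)
open import Data.Empty using (⊥)
open import Relation.Nullary using (¬_)
open import Relation.Binary.PropositionalEquality using (_≡_)

-- Ascent-sequence condition for the remainder of a sequence, given the
-- previous letter `prev` and the number `a` of ascents of the prefix so far.
AscOK : ℕ → ℕ → List ℕ → Set
AscOK prev a [] = ⊤
AscOK prev a (y ∷ ys) = (y ≤ suc a) × AscOK y (if prev <ᵇ y then suc a else a) ys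

IsAscentSeq : List ℕ → Set
IsAscentSeq [] = ⊥
IsAscentSeq (x ∷ xs) = (x ≡ 0) × AscOK x 0 xs

rank : List ℕ → ℕ → ℕ
rank w a = length (filter (λ c → any? (c ≟_) w) (upTo a))

red : List ℕ → List ℕ
red w = map (rank w) w

Contains : List ℕ → List ℕ → Set
Contains p x = ∃[ s ] (s ⊆ x × red s ≡ p)

Avoids : List ℕ → List ℕ → Set
Avoids p x = ¬ Contains p x

p0121 : List ℕ
p0121 = 0 ∷ 1 ∷ 2 ∷ 1 ∷ []

p0112 : List ℕ
p0112 = 0 ∷ 1 ∷ 1 ∷ 2 ∷ []

-- x ∈ 𝒞 = ⋃_{n≥1} 𝒜_n({0121, 0112})  (IsAscentSeq forces length ≥ 1)
InC : List ℕ → Set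
InC x = IsAscentSeq x × Avoids p0121 x × Avoids p0112 x

pos : List ℕ → List ℕ
pos x = filter (0 <?_) x

oneTo : ℕ → List ℕ
oneTo m = map suc (upTo m)

Label0 : List ℕ → Set
Label0 x = ∃[ i ] (1 ≤ i × x ≡ replicate i 0)

Label01 : List ℕ → Set
Label01 x = ∃[ m ] (1 ≤ m × pos x ≡ oneTo m)

Label011 : List ℕ → Set
Label011 x = ∃[ m ] ∃[ s ] (1 ≤ m × 2 ≤ s × pos x ≡ oneTo (m ∸ 1) ++ replicate s m)

Child : List ℕ → ℕ → Set
Child x t = InC (x ++ [ t ])

ExactlyOneLabel : List ℕ → Set
ExactlyOneLabel x =
  (Label0 x ⊎ Label01 x ⊎ Label011 x)
  × ¬ (Label0 x × Label01 x) × ¬ (Label0 x × Label011 x) × ¬ (Label01 x × Label011 x)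

TwoChildren : (List ℕ → Set) → (List ℕ → Set) → List ℕ → Set
TwoChildren L₁ L₂ x = ∃[ t₁ ] ∃[ t₂ ]
  ( ¬ (t₁ ≡ t₂)
  × Child x t₁ × Child x t₂
  × (∀ t → Child x t → t ≡ t₁ ⊎ t ≡ t₂)
  × L₁ (x ++ [ t₁ ]) × L₂ (x ++ [ t₂ ]))

ThreeChildren : (List ℕ → Set) → (List ℕ → Set) → (List ℕ → Set) → List ℕ → Set
ThreeChildren L₁ L₂ L₃ x = ∃[ t₁ ] ∃[ t₂ ] ∃[ t₃ ]
  ( ¬ (t₁ ≡ t₂) × ¬ (t₁ ≡ t₃) × ¬ (t₂ ≡ t₃)
  × Child x t₁ × Child x t₂ × Child x t₃
  × (∀ t → Child x t → t ≡ t₁ ⊎ t ≡ t₂ ⊎ t ≡ t₃)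
  × L₁ (x ++ [ t₁ ]) × L₂ (x ++ [ t₂ ]) × L₃ (x ++ [ t₃ ]))

-- Every x ∈ 𝒞 starts with 0, which can serve as the smallest letter of any occurrence.
-- Hence appending t creates a 0121 exactly when t is followed in x⁺ by a larger letter,
-- and a 0112 exactly when some letter below t is repeated in x⁺; the ascent condition
-- asks t ≤ 1 + asc x.  If x⁺ = 1 2 ⋯ m (label (0) being the case m = 0), then asc x = m,
-- because every ascent ends on a positive letter and every letter is at most asc x; so
-- the children are t = 0, m, m + 1.  If x⁺ = 1 ⋯ (m-1) mˢ with s ≥ 2, a letter 0 < t < m
-- is followed by m and a letter t > m lies above the repeated m, leaving t = 0, m.
-- Every x ∈ 𝒞 is reached from the root by appending letters, so it carries a label; the
-- labels are disjoint since only label (011) repeats a positive letter.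
module Submission where

open import Defs
open import Data.Bool using (true; false; if_then_else_)
open import Data.Empty using (⊥-elim)
open import Data.List
  using (List; []; _∷_; _++_; [_]; filter; length; replicate; reverse; upTo; applyUpTo)
open import Data.List.Properties
  using ( upTo-∷ʳ; applyUpTo-∷ʳ; map-upTo; length-upTo; length-map; length-++
        ; filter-++; filter-accept; filter-reject; filter-all; filter-none
        ; ++-identityʳ; ++-assoc; reverse-++ )
open import Data.List.Reverse using (Reverse; []; _∶_∶ʳ_; reverseView)
open import Data.List.Membership.Propositional using (_∈_; _∉_)
open import Data.List.Membership.Propositional.Properties using (∈-map⁺; ∈-upTo⁺; ∈-++⁺ʳ)
open import Data.List.Relation.Binary.Pointwise using (_∷_; []; ≡⇒Pointwise-≡; Pointwise-≡⇒≡)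
open import Data.List.Relation.Binary.Sublist.Propositional
  using (_⊆_; []; _∷_; _∷ʳ_; ⊆-refl; ⊆-trans; lookup; to∈; from∈; minimum)
open import Data.List.Relation.Binary.Sublist.Propositional.Properties
  using (length-mono-≤; reverse⁺; reverse⁻; filter-⊆; filter⁺; ∷⁻; ∷ˡ⁻; ++⁺; ++⁺ˡ; ++⁺ʳ)
open import Data.List.Relation.Unary.All as All using (All; _∷_; [])
open import Data.List.Relation.Unary.All.Properties as Allₚ using (all-filter; all-upTo)
open import Data.List.Relation.Unary.AllPairs using (AllPairs; _∷_)
import Data.List.Relation.Unary.AllPairs.Properties as AllPairsₚ
open import Data.List.Relation.Unary.Any using (any?; here; there)
open import Data.Nat
open import Data.Nat.Properties
open import Data.Product using (_×_; _,_; ∃-syntax; proj₁)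
open import Data.Sum using (_⊎_; inj₁; inj₂; map₂; [_,_]′)
open import Data.Unit using (tt)
open import Function using (_∘_; id)
open import Relation.Binary.Definitions using (tri<; tri≈; tri>)
open import Relation.Binary.PropositionalEquality
  using (_≡_; refl; sym; trans; cong; cong₂; subst; subst₂; module ≡-Reasoning)
open import Relation.Nullary using (¬_; contradiction; ofⁿ)
open import Relation.Unary using (Decidable)

module _ (w : List ℕ) where

  private
    ∈w? : Decidable (_∈ w)
    ∈w? c = any? (c ≟_) w

  rank-suc : ∀ n → rank w (suc n) ≡ rank w n + length (filter ∈w? [ n ])
  rank-suc n = begin
    length (filter ∈w? (upTo (suc n)))
      ≡⟨ cong (length ∘ filter ∈w?) (upTo-∷ʳ n) ⟨
    length (filter ∈w? (upTo n ++ [ n ]))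
      ≡⟨ cong length (filter-++ ∈w? (upTo n) [ n ]) ⟩
    length (filter ∈w? (upTo n) ++ filter ∈w? [ n ])
      ≡⟨ length-++ (filter ∈w? (upTo n)) ⟩
    rank w n + length (filter ∈w? [ n ])
      ∎
    where open ≡-Reasoning

  rank-suc-∈ : ∀ {n} → n ∈ w → rank w (suc n) ≡ suc (rank w n)
  rank-suc-∈ {n} n∈w = begin
    rank w (suc n)                        ≡⟨ rank-suc n ⟩
    rank w n + length (filter ∈w? [ n ])
      ≡⟨ cong (λ l → rank w n + length l) (filter-accept ∈w? n∈w) ⟩
    rank w n + 1                          ≡⟨ +-comm (rank w n) 1 ⟩
    suc (rank w n)                        ∎
    where open ≡-Reasoning

  rank-suc-∉ : ∀ {n} → n ∉ w → rank w (suc n) ≡ rank w n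
  rank-suc-∉ {n} n∉w = begin
    rank w (suc n)                        ≡⟨ rank-suc n ⟩
    rank w n + length (filter ∈w? [ n ])
      ≡⟨ cong (λ l → rank w n + length l) (filter-reject ∈w? n∉w) ⟩
    rank w n + 0                          ≡⟨ +-identityʳ (rank w n) ⟩
    rank w n                              ∎
    where open ≡-Reasoning

  rank-mono : ∀ {m n} → m ≤ n → rank w m ≤ rank w n
  rank-mono = go ∘ ≤⇒≤′
    where
    go : ∀ {m n} → m ≤′ n → rank w m ≤ rank w n
    go ≤′-refl              = ≤-refl
    go (≤′-step {n} m≤′n) =
      ≤-trans (go m≤′n) (≤-trans (m≤m+n _ _) (≤-reflexive (sym (rank-suc n))))

  rank-<-∈ : ∀ {m n} → m ∈ w → m < n → rank w m < rank w n
  rank-<-∈ m∈w m<n = ≤-trans (≤-reflexive (sym (rank-suc-∈ m∈w))) (rank-mono m<n)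

  rank-cancel-< : ∀ {m n} → rank w m < rank w n → m < n
  rank-cancel-< r = ≰⇒> (λ n≤m → <⇒≱ r (rank-mono n≤m))

  rank-injective-∈ : ∀ {m n} → m ∈ w → n ∈ w → rank w m ≡ rank w n → m ≡ n
  rank-injective-∈ {m} {n} m∈w n∈w r with <-cmp m n
  ... | tri< m<n _ _ = contradiction r (<⇒≢ (rank-<-∈ m∈w m<n))
  ... | tri≈ _ m≡n _ = m≡n
  ... | tri> _ _ n<m = contradiction (sym r) (<⇒≢ (rank-<-∈ n∈w n<m))

  rank-gap : ∀ {lo hi} → lo ≤ hi → All (λ k → k < lo ⊎ hi ≤ k) w → rank w hi ≡ rank w lo
  rank-gap = go ∘ ≤⇒≤′
    where
    go : ∀ {lo hi} → lo ≤′ hi → All (λ k → k < lo ⊎ hi ≤ k) w → rank w hi ≡ rank w lo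
    go ≤′-refl             _   = refl
    go (≤′-step {n} lo≤′n) gap =
      trans (rank-suc-∉ n∉w) (go lo≤′n (All.map (map₂ ≤⇒pred≤) gap))
      where
      n∉w : n ∉ w
      n∉w n∈w with All.lookup gap n∈w
      ... | inj₁ n<lo  = <⇒≱ n<lo (≤′⇒≤ lo≤′n)
      ... | inj₂ n+1≤n = <-irrefl refl n+1≤n

  rank-three : ∀ {a b c} → a < b → b < c → a ∈ w → b ∈ w →
               All (λ k → k ≡ a ⊎ k ≡ b ⊎ k ≡ c) w →
               rank w a ≡ 0 × rank w b ≡ 1 × rank w c ≡ 2
  rank-three {a} {b} {c} a<b b<c a∈w b∈w abc = ra , rb , rc
    where
    ra : rank w a ≡ 0
    ra = rank-gap z≤n (All.map above₀ abc)
      where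
      above₀ : ∀ {k} → k ≡ a ⊎ k ≡ b ⊎ k ≡ c → k < 0 ⊎ a ≤ k
      above₀ (inj₁ refl)        = inj₂ ≤-refl
      above₀ (inj₂ (inj₁ refl)) = inj₂ (<⇒≤ a<b)
      above₀ (inj₂ (inj₂ refl)) = inj₂ (<⇒≤ (<-trans a<b b<c))
    rb : rank w b ≡ 1
    rb = trans (rank-gap a<b (All.map between₁ abc)) (trans (rank-suc-∈ a∈w) (cong suc ra))
      where
      between₁ : ∀ {k} → k ≡ a ⊎ k ≡ b ⊎ k ≡ c → k < suc a ⊎ b ≤ k
      between₁ (inj₁ refl)        = inj₁ ≤-refl
      between₁ (inj₂ (inj₁ refl)) = inj₂ ≤-refl
      between₁ (inj₂ (inj₂ refl)) = inj₂ (<⇒≤ b<c)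
    rc : rank w c ≡ 2
    rc = trans (rank-gap b<c (All.map between₂ abc)) (trans (rank-suc-∈ b∈w) (cong suc rb))
      where
      between₂ : ∀ {k} → k ≡ a ⊎ k ≡ b ⊎ k ≡ c → k < suc b ⊎ c ≤ k
      between₂ (inj₁ refl)        = inj₁ (m≤n⇒m≤1+n a<b)
      between₂ (inj₂ (inj₁ refl)) = inj₁ ≤-refl
      between₂ (inj₂ (inj₂ refl)) = inj₂ ≤-refl

ABCB : List ℕ → Set
ABCB x = ∃[ a ] ∃[ b ] ∃[ c ] (a < b × b < c × a ∷ b ∷ c ∷ b ∷ [] ⊆ x)

ABBC : List ℕ → Set
ABBC x = ∃[ a ] ∃[ b ] ∃[ c ] (a < b × b < c × a ∷ b ∷ b ∷ c ∷ [] ⊆ x)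

0121⇒ABCB : ∀ {x} → Contains p0121 x → ABCB x
0121⇒ABCB ([] , _ , ())
0121⇒ABCB (_ ∷ [] , _ , ())
0121⇒ABCB (_ ∷ _ ∷ [] , _ , ())
0121⇒ABCB (_ ∷ _ ∷ _ ∷ [] , _ , ())
0121⇒ABCB (_ ∷ _ ∷ _ ∷ _ ∷ _ ∷ _ , _ , ())
0121⇒ABCB {x} (a ∷ b ∷ c ∷ d ∷ [] , τ , red≡) with ≡⇒Pointwise-≡ red≡
... | ra ∷ rb ∷ rc ∷ rd ∷ [] =
  a , b , c , a<b , b<c , subst (λ z → a ∷ b ∷ c ∷ z ∷ [] ⊆ x) d≡b τ
  where
  w : List ℕ
  w = a ∷ b ∷ c ∷ d ∷ []
  a<b : a < b
  a<b = rank-cancel-< w (subst₂ _<_ (sym ra) (sym rb) z<s)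
  b<c : b < c
  b<c = rank-cancel-< w (subst₂ _<_ (sym rb) (sym rc) (s<s z<s))
  d≡b : d ≡ b
  d≡b = rank-injective-∈ w (there (there (there (here refl)))) (there (here refl)) (trans rd (sym rb))

ABCB⇒0121 : ∀ {x} → ABCB x → Contains p0121 x
ABCB⇒0121 (a , b , c , a<b , b<c , τ) =
  let ra , rb , rc = rank-three (a ∷ b ∷ c ∷ b ∷ []) a<b b<c (here refl) (there (here refl)) letters
  in  _ , τ , Pointwise-≡⇒≡ (ra ∷ rb ∷ rc ∷ rb ∷ [])
  where
  letters : All (λ k → k ≡ a ⊎ k ≡ b ⊎ k ≡ c) (a ∷ b ∷ c ∷ b ∷ [])
  letters = inj₁ refl ∷ inj₂ (inj₁ refl) ∷ inj₂ (inj₂ refl) ∷ inj₂ (inj₁ refl) ∷ []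

0112⇒ABBC : ∀ {x} → Contains p0112 x → ABBC x
0112⇒ABBC ([] , _ , ())
0112⇒ABBC (_ ∷ [] , _ , ())
0112⇒ABBC (_ ∷ _ ∷ [] , _ , ())
0112⇒ABBC (_ ∷ _ ∷ _ ∷ [] , _ , ())
0112⇒ABBC (_ ∷ _ ∷ _ ∷ _ ∷ _ ∷ _ , _ , ())
0112⇒ABBC {x} (a ∷ b ∷ c ∷ d ∷ [] , τ , red≡) with ≡⇒Pointwise-≡ red≡
... | ra ∷ rb ∷ rc ∷ rd ∷ [] =
  a , b , d , a<b , b<d , subst (λ z → a ∷ b ∷ z ∷ d ∷ [] ⊆ x) c≡b τ
  where
  w : List ℕ
  w = a ∷ b ∷ c ∷ d ∷ []
  a<b : a < b
  a<b = rank-cancel-< w (subst₂ _<_ (sym ra) (sym rb) z<s)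
  b<d : b < d
  b<d = rank-cancel-< w (subst₂ _<_ (sym rb) (sym rd) (s<s z<s))
  c≡b : c ≡ b
  c≡b = rank-injective-∈ w (there (there (here refl))) (there (here refl)) (trans rc (sym rb))

ABBC⇒0112 : ∀ {x} → ABBC x → Contains p0112 x
ABBC⇒0112 (a , b , c , a<b , b<c , τ) =
  let ra , rb , rc = rank-three (a ∷ b ∷ b ∷ c ∷ []) a<b b<c (here refl) (there (here refl)) letters
  in  _ , τ , Pointwise-≡⇒≡ (ra ∷ rb ∷ rb ∷ rc ∷ [])
  where
  letters : All (λ k → k ≡ a ⊎ k ≡ b ⊎ k ≡ c) (a ∷ b ∷ b ∷ c ∷ [])
  letters = inj₁ refl ∷ inj₂ (inj₁ refl) ∷ inj₂ (inj₁ refl) ∷ inj₂ (inj₂ refl) ∷ []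

Contains⇒length≤ : ∀ {p x} → Contains p x → length p ≤ length x
Contains⇒length≤ (s , τ , refl) = ≤-trans (≤-reflexive (length-map _ s)) (length-mono-≤ τ)

Contains-mono : ∀ {p x y} → x ⊆ y → Contains p x → Contains p y
Contains-mono x⊆y (s , τ , red≡) = s , ⊆-trans τ x⊆y , red≡

∷ʳ-⊆-∷ʳ⁻ : ∀ {A : Set} {xs ys : List A} {x y} →
            xs ++ [ x ] ⊆ ys ++ [ y ] → xs ++ [ x ] ⊆ ys ⊎ (x ≡ y × xs ⊆ ys)
∷ʳ-⊆-∷ʳ⁻ {xs = xs} {ys} {x} {y} τ
  with subst₂ _⊆_ (reverse-++ xs [ x ]) (reverse-++ ys [ y ]) (reverse⁺ τ)
... | _ ∷ʳ σ   = inj₁ (reverse⁻ (subst (_⊆ reverse ys) (sym (reverse-++ xs [ x ])) σ))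
... | x≡y ∷ σ = inj₂ (x≡y , reverse⁻ σ)

ABCB-∷ʳ⁻ : ∀ {x t} → ABCB (x ++ [ t ]) →
           ABCB x ⊎ ∃[ a ] ∃[ c ] (a < t × t < c × a ∷ t ∷ c ∷ [] ⊆ x)
ABCB-∷ʳ⁻ (a , b , c , a<b , b<c , τ) with ∷ʳ-⊆-∷ʳ⁻ {xs = a ∷ b ∷ c ∷ []} τ
... | inj₁ σ          = inj₁ (a , b , c , a<b , b<c , σ)
... | inj₂ (refl , σ) = inj₂ (a , c , a<b , b<c , σ)

ABBC-∷ʳ⁻ : ∀ {x t} → ABBC (x ++ [ t ]) →
           ABBC x ⊎ ∃[ a ] ∃[ b ] (a < b × b < t × a ∷ b ∷ b ∷ [] ⊆ x)
ABBC-∷ʳ⁻ (a , b , c , a<b , b<c , τ) with ∷ʳ-⊆-∷ʳ⁻ {xs = a ∷ b ∷ b ∷ []} τ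
... | inj₁ σ          = inj₁ (a , b , c , a<b , b<c , σ)
... | inj₂ (refl , σ) = inj₂ (a , b , a<b , b<c , σ)

pos-positive : ∀ {t} x → t ∈ pos x → 0 < t
pos-positive x = All.lookup (all-filter (0 <?_) x)

pos-⊆ : ∀ x → pos x ⊆ x
pos-⊆ = filter-⊆ (0 <?_)

⊆-pos⁺ : ∀ {s x} → All (0 <_) s → s ⊆ x → s ⊆ pos x
⊆-pos⁺ {s} {x} s⁺ τ =
  subst (_⊆ pos x) (filter-all (0 <?_) s⁺) (filter⁺ (0 <?_) (0 <?_) (λ { refl → id }) τ)

ascents : ℕ → ℕ → List ℕ → ℕ
ascents prev a []       = a
ascents prev a (y ∷ ys) = ascents y (if prev <ᵇ y then suc a else a) ys

asc : List ℕ → ℕ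
asc []       = 0
asc (x ∷ xs) = ascents x 0 xs

AscOK-++⁻ˡ : ∀ {prev a} xs {ys} → AscOK prev a (xs ++ ys) → AscOK prev a xs
AscOK-++⁻ˡ []       _          = tt
AscOK-++⁻ˡ (x ∷ xs) (x≤ , ok) = x≤ , AscOK-++⁻ˡ xs ok

AscOK-∷ʳ⁻ : ∀ {prev a t} xs → AscOK prev a (xs ++ [ t ]) → t ≤ suc (ascents prev a xs)
AscOK-∷ʳ⁻ []       (t≤ , _) = t≤
AscOK-∷ʳ⁻ (x ∷ xs) (_ , ok) = AscOK-∷ʳ⁻ xs ok

AscOK-∷ʳ⁺ : ∀ {prev a t} xs → AscOK prev a xs → t ≤ suc (ascents prev a xs) →
            AscOK prev a (xs ++ [ t ])
AscOK-∷ʳ⁺ []       _          t≤ = t≤ , tt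
AscOK-∷ʳ⁺ (x ∷ xs) (x≤ , ok) t≤ = x≤ , AscOK-∷ʳ⁺ xs ok t≤

≤-ascents : ∀ prev a xs → a ≤ ascents prev a xs
≤-ascents prev a []       = ≤-refl
≤-ascents prev a (y ∷ ys) with prev <ᵇ y
... | true  = ≤-trans (n≤1+n a) (≤-ascents y (suc a) ys)
... | false = ≤-ascents y a ys

ascents≤ : ∀ prev a xs → ascents prev a xs ≤ a + length (pos xs)
ascents≤ prev a []             = ≤-reflexive (sym (+-identityʳ a))
ascents≤ prev a (zero ∷ ys)    = ascents≤ zero a ys
ascents≤ prev a (suc k ∷ ys) with prev <ᵇ suc k
... | true  = ≤-trans (ascents≤ (suc k) (suc a) ys) (≤-reflexive (sym (+-suc a _)))
... | false = ≤-trans (ascents≤ (suc k) a ys) (+-monoʳ-≤ a (n≤1+n _))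

AscOK⇒All≤ascents : ∀ {prev a} xs → prev ≤ a → AscOK prev a xs → All (_≤ ascents prev a xs) xs
AscOK⇒All≤ascents []                   _      _         = []
AscOK⇒All≤ascents {prev} {a} (y ∷ ys) prev≤a (y≤1+a , ok) =
  ≤-trans y≤a′ (≤-ascents y _ ys) ∷ AscOK⇒All≤ascents ys y≤a′ ok
  where
  y≤a′ : y ≤ (if prev <ᵇ y then suc a else a)
  y≤a′ with prev <ᵇ y | <ᵇ-reflects-< prev y
  ... | true  | _           = y≤1+a
  ... | false | ofⁿ prev≮y = ≤-trans (≮⇒≥ prev≮y) prev≤a

IsAscentSeq⇒All≤asc : ∀ {x} → IsAscentSeq x → All (_≤ asc x) x
IsAscentSeq⇒All≤asc {_ ∷ xs} (refl , ok) = z≤n ∷ AscOK⇒All≤ascents xs z≤n ok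

asc≤length-pos : ∀ {x} → IsAscentSeq x → asc x ≤ length (pos x)
asc≤length-pos {_ ∷ xs} (refl , _) = ascents≤ 0 0 xs

pos-≤asc : ∀ {x t} → IsAscentSeq x → t ∈ pos x → t ≤ asc x
pos-≤asc {x} x-asc t∈ = All.lookup (IsAscentSeq⇒All≤asc x-asc) (lookup (pos-⊆ x) t∈)

LargerAfter : ℕ → List ℕ → Set
LargerAfter t w = ∃[ c ] (t < c × t ∷ c ∷ [] ⊆ w)

RepeatedBelow : ℕ → List ℕ → Set
RepeatedBelow t w = ∃[ b ] (b < t × b ∷ b ∷ [] ⊆ w)

Appendable : List ℕ → ℕ → Set
Appendable x t = t ≤ suc (asc x) × ¬ LargerAfter t (pos x) × ¬ RepeatedBelow t (pos x)

child⇒appendable : ∀ {x t} → InC x → Child x t → Appendable x t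
child⇒appendable {[]}     (() , _)
child⇒appendable {_ ∷ ys} {t} _ ((refl , ok) , ∌0121 , ∌0112) =
  AscOK-∷ʳ⁻ ys ok , no-larger , no-repeat
  where
  then-t : ∀ {s} → s ⊆ pos ys → 0 ∷ s ++ [ t ] ⊆ 0 ∷ ys ++ [ t ]
  then-t τ = refl ∷ ++⁺ (⊆-trans τ (pos-⊆ ys)) (refl ∷ [])
  no-larger : ¬ LargerAfter t (pos ys)
  no-larger (c , t<c , τ) = ∌0121 (ABCB⇒0121 (0 , t , c , pos-positive ys (to∈ τ) , t<c , then-t τ))
  no-repeat : ¬ RepeatedBelow t (pos ys)
  no-repeat (b , b<t , τ) = ∌0112 (ABBC⇒0112 (0 , b , t , pos-positive ys (to∈ τ) , b<t , then-t τ))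

appendable⇒child : ∀ {x t} → InC x → Appendable x t → Child x t
appendable⇒child {_ ∷ ys} {t} ((refl , ok) , ∌0121 , ∌0112) (t≤ , no-larger , no-repeat) =
  (refl , AscOK-∷ʳ⁺ ys ok t≤) , ∌ABCB ∘ 0121⇒ABCB , ∌ABBC ∘ 0112⇒ABBC
  where
  ∌ABCB : ¬ ABCB ((0 ∷ ys) ++ [ t ])
  ∌ABCB abcb with ABCB-∷ʳ⁻ abcb
  ... | inj₁ abcb′                  = ∌0121 (ABCB⇒0121 abcb′)
  ... | inj₂ (a , c , a<t , t<c , σ) =
    no-larger (c , t<c , ⊆-pos⁺ (m<n⇒0<n a<t ∷ m<n⇒0<n t<c ∷ []) (∷⁻ σ))
  ∌ABBC : ¬ ABBC ((0 ∷ ys) ++ [ t ])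
  ∌ABBC abbc with ABBC-∷ʳ⁻ abbc
  ... | inj₁ abbc′                  = ∌0112 (ABBC⇒0112 abbc′)
  ... | inj₂ (a , b , a<b , b<t , σ) =
    no-repeat (b , b<t , ⊆-pos⁺ (m<n⇒0<n a<b ∷ m<n⇒0<n a<b ∷ []) (∷⁻ σ))

child-zero : ∀ {x} → InC x → Child x 0
child-zero {x} x∈C = appendable⇒child x∈C (z≤n , no-larger , λ ())
  where
  no-larger : ¬ LargerAfter 0 (pos x)
  no-larger (_ , _ , τ) = <-irrefl refl (pos-positive x (to∈ τ))

bounded⇒¬LargerAfter : ∀ {t w} → All (_≤ t) w → ¬ LargerAfter t w
bounded⇒¬LargerAfter w≤t (c , t<c , τ) = <⇒≱ t<c (All.lookup w≤t (to∈ (∷ˡ⁻ τ)))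

increasing⇒no-repeat : ∀ {b xs} → AllPairs _<_ xs → ¬ (b ∷ b ∷ [] ⊆ xs)
increasing⇒no-repeat (_ ∷ ps)    (_ ∷ʳ τ)   = increasing⇒no-repeat ps τ
increasing⇒no-repeat (b<xs ∷ _) (refl ∷ τ) = <-irrefl refl (All.lookup b<xs (to∈ τ))

replicate-∷ʳ : ∀ {A : Set} n (v : A) → replicate n v ++ [ v ] ≡ replicate (suc n) v
replicate-∷ʳ zero    v = refl
replicate-∷ʳ (suc n) v = cong (v ∷_) (replicate-∷ʳ n v)

pos-replicate-zero : ∀ n → pos (replicate n 0) ≡ []
pos-replicate-zero zero    = refl
pos-replicate-zero (suc n) = pos-replicate-zero n

pos-∷ʳ-zero : ∀ x → pos (x ++ [ 0 ]) ≡ pos x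
pos-∷ʳ-zero x = trans (filter-++ (0 <?_) x [ 0 ]) (++-identityʳ (pos x))

pos-∷ʳ-suc : ∀ x k → pos (x ++ [ suc k ]) ≡ pos x ++ [ suc k ]
pos-∷ʳ-suc x k = filter-++ (0 <?_) x [ suc k ]

oneTo-∷ʳ : ∀ m → oneTo m ++ [ suc m ] ≡ oneTo (suc m)
oneTo-∷ʳ m = begin
  oneTo m ++ [ suc m ]          ≡⟨ cong (_++ [ suc m ]) (map-upTo suc m) ⟩
  applyUpTo suc m ++ [ suc m ]  ≡⟨ applyUpTo-∷ʳ suc m ⟩
  applyUpTo suc (suc m)         ≡⟨ map-upTo suc (suc m) ⟨
  oneTo (suc m)                 ∎
  where open ≡-Reasoning

length-oneTo : ∀ m → length (oneTo m) ≡ m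
length-oneTo m = trans (length-map suc (upTo m)) (length-upTo m)

oneTo-≤ : ∀ m → All (_≤ m) (oneTo m)
oneTo-≤ m = Allₚ.map⁺ (all-upTo m)

oneTo-increasing : ∀ m → AllPairs _<_ (oneTo m)
oneTo-increasing m = AllPairsₚ.map⁺ (AllPairsₚ.applyUpTo⁺₁ id m (λ i<j _ → s≤s i<j))

∈-oneTo : ∀ {t m} → 0 < t → t ≤ m → t ∈ oneTo m
∈-oneTo {suc t} _ t<m = ∈-map⁺ suc (∈-upTo⁺ t<m)

LargerAfter-oneTo : ∀ {t m} → 0 < t → t < m → LargerAfter t (oneTo m)
LargerAfter-oneTo {t} {suc k} 0<t t<m =
  suc k , t<m , subst (t ∷ suc k ∷ [] ⊆_) (oneTo-∷ʳ k)
                   (++⁺ (from∈ (∈-oneTo 0<t (≤-pred t<m))) (refl ∷ []))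

LargerAfter-mono : ∀ {t v w} → v ⊆ w → LargerAfter t v → LargerAfter t w
LargerAfter-mono v⊆w (c , t<c , τ) = c , t<c , ⊆-trans τ v⊆w

stair-top≤asc : ∀ {x} m → IsAscentSeq x → pos x ≡ oneTo m → m ≤ asc x
stair-top≤asc zero    _     _    = z≤n
stair-top≤asc (suc k) x-asc pos≡ =
  pos-≤asc x-asc (subst (suc k ∈_) (sym pos≡) (∈-oneTo z<s ≤-refl))

module Staircase {x m} (x∈C : InC x) (pos≡ : pos x ≡ oneTo m) where

  asc≡ : asc x ≡ m
  asc≡ = ≤-antisym asc≤m (stair-top≤asc m (proj₁ x∈C) pos≡)
    where
    asc≤m : asc x ≤ m
    asc≤m = ≤-trans (asc≤length-pos (proj₁ x∈C))
                    (≤-reflexive (trans (cong length pos≡) (length-oneTo m)))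

  child⁺ : ∀ {t} → m ≤ t → t ≤ suc m → Child x t
  child⁺ {t} m≤t t≤1+m = appendable⇒child x∈C (t≤ , no-larger , no-repeat)
    where
    t≤ : t ≤ suc (asc x)
    t≤ = subst (λ a → t ≤ suc a) (sym asc≡) t≤1+m
    no-larger : ¬ LargerAfter t (pos x)
    no-larger = bounded⇒¬LargerAfter
      (subst (All (_≤ t)) (sym pos≡) (All.map (λ i≤m → ≤-trans i≤m m≤t) (oneTo-≤ m)))
    no-repeat : ¬ RepeatedBelow t (pos x)
    no-repeat (_ , _ , τ) =
      increasing⇒no-repeat (oneTo-increasing m) (subst (_ ∷ _ ∷ [] ⊆_) pos≡ τ)

  child⁻ : ∀ {t} → Child x t → t ≡ 0 ⊎ t ≡ m ⊎ t ≡ suc m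
  child⁻ {zero}  _ = inj₁ refl
  child⁻ {suc t} c with child⇒appendable x∈C c | <-cmp (suc t) m
  ... | _ , _ , _         | tri≈ _ t≡m _ = inj₂ (inj₁ t≡m)
  ... | t≤ , _ , _        | tri> _ _ m<t =
    inj₂ (inj₂ (≤-antisym (subst (λ a → suc t ≤ suc a) asc≡ t≤) m<t))
  ... | _ , no-larger , _ | tri< t<m _ _ =
    ⊥-elim (no-larger (subst (LargerAfter (suc t)) (sym pos≡) (LargerAfter-oneTo z<s t<m)))

plateau-≤ : ∀ k s → All (_≤ suc k) (oneTo k ++ replicate s (suc k))
plateau-≤ k s = Allₚ.++⁺ (All.map m≤n⇒m≤1+n (oneTo-≤ k)) (Allₚ.replicate⁺ s ≤-refl)

plateau-no-repeat-below : ∀ {b k s} → b < suc k → ¬ (b ∷ b ∷ [] ⊆ oneTo k ++ replicate s (suc k))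
plateau-no-repeat-below {b} {k} {s} b<m τ =
  increasing⇒no-repeat (oneTo-increasing k)
    (subst₂ _⊆_ (filter-all (_<? suc k) (b<m ∷ b<m ∷ [])) below-top
                (filter⁺ (_<? suc k) (_<? suc k) (λ { refl → id }) τ))
  where
  open ≡-Reasoning
  below-top : filter (_<? suc k) (oneTo k ++ replicate s (suc k)) ≡ oneTo k
  below-top = begin
    filter (_<? suc k) (oneTo k ++ replicate s (suc k))
      ≡⟨ filter-++ (_<? suc k) (oneTo k) (replicate s (suc k)) ⟩
    filter (_<? suc k) (oneTo k) ++ filter (_<? suc k) (replicate s (suc k))
      ≡⟨ cong₂ _++_ (filter-all (_<? suc k) (All.map s≤s (oneTo-≤ k)))
                    (filter-none (_<? suc k) (Allₚ.replicate⁺ s (<-irrefl refl))) ⟩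
    oneTo k ++ []
      ≡⟨ ++-identityʳ (oneTo k) ⟩
    oneTo k ∎

plateau-child⁺ : ∀ {x k s} → InC x → pos x ≡ oneTo k ++ replicate (suc s) (suc k) →
                 Child x (suc k)
plateau-child⁺ {x} {k} {s} x∈C pos≡ = appendable⇒child x∈C (t≤ , no-larger , no-repeat)
  where
  t≤ : suc k ≤ suc (asc x)
  t≤ = m≤n⇒m≤1+n
    (pos-≤asc (proj₁ x∈C) (subst (suc k ∈_) (sym pos≡) (∈-++⁺ʳ (oneTo k) (here refl))))
  no-larger : ¬ LargerAfter (suc k) (pos x)
  no-larger = bounded⇒¬LargerAfter (subst (All (_≤ suc k)) (sym pos≡) (plateau-≤ k (suc s)))
  no-repeat : ¬ RepeatedBelow (suc k) (pos x)
  no-repeat (_ , b<m , τ) = plateau-no-repeat-below b<m (subst (_ ∷ _ ∷ [] ⊆_) pos≡ τ)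

plateau-child⁻ : ∀ {x k s t} → InC x → pos x ≡ oneTo k ++ replicate (2 + s) (suc k) →
                 Child x t → t ≡ 0 ⊎ t ≡ suc k
plateau-child⁻ {t = zero}  _ _ _ = inj₁ refl
plateau-child⁻ {x} {k} {s} {suc t} x∈C pos≡ c
  with child⇒appendable x∈C c | <-cmp (suc t) (suc k)
... | _ , _ , _         | tri≈ _ t≡m _ = inj₂ t≡m
... | _ , no-larger , _ | tri< t<m _ _ =
  ⊥-elim (no-larger (subst (LargerAfter (suc t)) (sym pos≡)
                            (LargerAfter-mono stair⊆plateau (LargerAfter-oneTo z<s t<m))))
  where
  stair⊆plateau : oneTo (suc k) ⊆ oneTo k ++ replicate (2 + s) (suc k)
  stair⊆plateau =
    subst (_⊆ oneTo k ++ replicate (2 + s) (suc k)) (oneTo-∷ʳ k) (++⁺ ⊆-refl (refl ∷ minimum _))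
... | _ , _ , no-repeat | tri> _ _ m<t =
  ⊥-elim (no-repeat (suc k , m<t , subst (_ ⊆_) (sym pos≡) (++⁺ˡ (oneTo k) (refl ∷ refl ∷ minimum _))))

pos-stair-∷ʳ : ∀ x {m} → pos x ≡ oneTo m → pos (x ++ [ suc m ]) ≡ oneTo (suc m)
pos-stair-∷ʳ x {m} pos≡ = trans (pos-∷ʳ-suc x m) (trans (cong (_++ [ suc m ]) pos≡) (oneTo-∷ʳ m))

pos-plateau-∷ʳ : ∀ x {k s} → pos x ≡ oneTo k ++ replicate s (suc k) →
                 pos (x ++ [ suc k ]) ≡ oneTo k ++ replicate (suc s) (suc k)
pos-plateau-∷ʳ x {k} {s} pos≡ = begin
  pos (x ++ [ suc k ])                           ≡⟨ pos-∷ʳ-suc x k ⟩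
  pos x ++ [ suc k ]                             ≡⟨ cong (_++ [ suc k ]) pos≡ ⟩
  (oneTo k ++ replicate s (suc k)) ++ [ suc k ]  ≡⟨ ++-assoc (oneTo k) (replicate s (suc k)) [ suc k ] ⟩
  oneTo k ++ replicate s (suc k) ++ [ suc k ]    ≡⟨ cong (oneTo k ++_) (replicate-∷ʳ s (suc k)) ⟩
  oneTo k ++ replicate (suc s) (suc k)           ∎
  where open ≡-Reasoning

children-Label0 : ∀ x → InC x → Label0 x → TwoChildren Label0 Label01 x
children-Label0 _ x∈C (suc j , _ , refl) =
  0 , 1 , (λ ()) , child-zero x∈C , child⁺ z≤n ≤-refl ,
  (λ _ → [ inj₁ , [ inj₁ , inj₂ ]′ ]′ ∘ child⁻) ,
  (suc (suc j) , s≤s z≤n , cong (0 ∷_) (replicate-∷ʳ j 0)) ,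
  (1 , ≤-refl , pos-stair-∷ʳ (replicate (suc j) 0) pos≡)
  where
  pos≡ : pos (replicate (suc j) 0) ≡ oneTo 0
  pos≡ = pos-replicate-zero (suc j)
  open Staircase x∈C pos≡

children-Label01 : ∀ x → InC x → Label01 x → ThreeChildren Label01 Label011 Label01 x
children-Label01 x x∈C (suc k , _ , pos≡) =
  0 , suc k , suc (suc k) , (λ ()) , (λ ()) , 1+n≢n ∘ sym ,
  child-zero x∈C , child⁺ ≤-refl (n≤1+n _) , child⁺ (n≤1+n _) ≤-refl , (λ _ → child⁻) ,
  (suc k , s≤s z≤n , trans (pos-∷ʳ-zero x) pos≡) ,
  (suc k , 2 , s≤s z≤n , ≤-refl , pos-plateau-∷ʳ x (trans pos≡ (sym (oneTo-∷ʳ k)))) ,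
  (suc (suc k) , s≤s z≤n , pos-stair-∷ʳ x pos≡)
  where open Staircase x∈C pos≡

children-Label011 : ∀ x → InC x → Label011 x → TwoChildren Label011 Label011 x
children-Label011 _ _ (zero , _ , () , _)
children-Label011 _ _ (suc _ , zero , _ , () , _)
children-Label011 _ _ (suc _ , suc zero , _ , s≤s () , _)
children-Label011 x x∈C (suc k , suc (suc s) , _ , 2≤s , pos≡) =
  0 , suc k , (λ ()) , child-zero x∈C , plateau-child⁺ x∈C pos≡ ,
  (λ _ → plateau-child⁻ x∈C pos≡) ,
  (suc k , 2 + s , s≤s z≤n , 2≤s , trans (pos-∷ʳ-zero x) pos≡) ,
  (suc k , 3 + s , s≤s z≤n , m≤n⇒m≤1+n 2≤s , pos-plateau-∷ʳ x pos≡)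

TwoChildren-label : ∀ L₁ L₂ {x t} → TwoChildren L₁ L₂ x → Child x t →
                    L₁ (x ++ [ t ]) ⊎ L₂ (x ++ [ t ])
TwoChildren-label _ _ {t = t} (_ , _ , _ , _ , _ , only , l₁ , l₂) c with only t c
... | inj₁ refl = inj₁ l₁
... | inj₂ refl = inj₂ l₂

ThreeChildren-label : ∀ L₁ L₂ L₃ {x t} → ThreeChildren L₁ L₂ L₃ x → Child x t →
                      L₁ (x ++ [ t ]) ⊎ L₂ (x ++ [ t ]) ⊎ L₃ (x ++ [ t ])
ThreeChildren-label _ _ _ {t = t} (_ , _ , _ , _ , _ , _ , _ , _ , _ , only , l₁ , l₂ , l₃) c
  with only t c
... | inj₁ refl        = inj₁ l₁
... | inj₂ (inj₁ refl) = inj₂ (inj₁ l₂)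
... | inj₂ (inj₂ refl) = inj₂ (inj₂ l₃)

Labelled : List ℕ → Set
Labelled x = Label0 x ⊎ Label01 x ⊎ Label011 x

child-Labelled : ∀ {x t} → InC x → Labelled x → Child x t → Labelled (x ++ [ t ])
child-Labelled {x} x∈C (inj₁ l) c =
  map₂ inj₁ (TwoChildren-label Label0 Label01 (children-Label0 x x∈C l) c)
child-Labelled {x} x∈C (inj₂ (inj₁ l)) c =
  [ inj₂ ∘ inj₁ , [ inj₂ ∘ inj₂ , inj₂ ∘ inj₁ ]′ ]′
    (ThreeChildren-label Label01 Label011 Label01 (children-Label01 x x∈C l) c)
child-Labelled {x} x∈C (inj₂ (inj₂ l)) c =
  inj₂ (inj₂ ([ id , id ]′ (TwoChildren-label Label011 Label011 (children-Label011 x x∈C l) c)))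

InC-prefix : ∀ {y ys zs} → InC (y ∷ ys ++ zs) → InC (y ∷ ys)
InC-prefix {y} {ys} {zs} ((y≡0 , ok) , ∌0121 , ∌0112) =
  (y≡0 , AscOK-++⁻ˡ ys ok) , ∌0121 ∘ Contains-mono prefix , ∌0112 ∘ Contains-mono prefix
  where
  prefix : y ∷ ys ⊆ y ∷ ys ++ zs
  prefix = ++⁺ʳ zs ⊆-refl

labelled : ∀ {x} → InC x → Labelled x
labelled {x} = go (reverseView x)
  where
  go : ∀ {x} → Reverse x → InC x → Labelled x
  go []                      (() , _)
  go ([] ∶ _ ∶ʳ _)           ((refl , _) , _) = inj₁ (1 , ≤-refl , refl)
  go ((_ ∷ _) ∶ r ∶ʳ _) x∈C = child-Labelled (InC-prefix x∈C) (go r (InC-prefix x∈C)) x∈C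

Label0⇒pos≡[] : ∀ x → Label0 x → pos x ≡ []
Label0⇒pos≡[] _ (i , _ , refl) = pos-replicate-zero i

Label011⇒repeat : ∀ x → Label011 x → ∃[ m ] (m ∷ m ∷ [] ⊆ pos x)
Label011⇒repeat _ (_ , zero , _ , () , _)
Label011⇒repeat _ (_ , suc zero , _ , s≤s () , _)
Label011⇒repeat _ (m , suc (suc _) , _ , _ , pos≡) =
  m , subst (_ ⊆_) (sym pos≡) (++⁺ˡ _ (refl ∷ refl ∷ minimum _))

exactly-one-label : ∀ {x} → InC x → ExactlyOneLabel x
exactly-one-label {x} x∈C = labelled x∈C , not-0-01 , not-0-011 , not-01-011
  where
  not-0-01 : ¬ (Label0 x × Label01 x)
  not-0-01 (_  , zero , () , _)
  not-0-01 (l0 , suc _ , _ , pos≡) with trans (sym (Label0⇒pos≡[] x l0)) pos≡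
  ... | ()
  not-0-011 : ¬ (Label0 x × Label011 x)
  not-0-011 (l0 , l011) with Label011⇒repeat x l011
  ... | _ , τ with subst (_ ⊆_) (Label0⇒pos≡[] x l0) τ
  ...   | ()
  not-01-011 : ¬ (Label01 x × Label011 x)
  not-01-011 ((m , _ , pos≡) , l011) with Label011⇒repeat x l011
  ... | _ , τ = increasing⇒no-repeat (oneTo-increasing m) (subst (_ ⊆_) pos≡ τ)

root∈C : InC (0 ∷ [])
root∈C = (refl , tt) , too-long ∘ Contains⇒length≤ , too-long ∘ Contains⇒length≤
  where
  too-long : ¬ (4 ≤ 1)
  too-long (s≤s ())

lemma3p3 : (∀ (x : List ℕ) → InC x → ExactlyOneLabel x)
    × (∀ (x : List ℕ) → InC x → Label0 x → TwoChildren Label0 Label01 x)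
    × (∀ (x : List ℕ) → InC x → Label01 x → ThreeChildren Label01 Label011 Label01 x)
    × (∀ (x : List ℕ) → InC x → Label011 x → TwoChildren Label011 Label011 x)
    × InC (0 ∷ []) × Label0 (0 ∷ [])
lemma3p3 =
  (λ _ → exactly-one-label) ,
  children-Label0 , children-Label01 , children-Label011 ,
  root∈C , (1 , ≤-refl , refl)
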